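{- Let $(\mathcal P,\mathcal O)$ be a 3-twined semitopology and $f,f':\mathcal P\to\mathbf 3$. Then (1) $\mathsf{Quorum}(f\vee f')\le\mathsf{Contraquorum} f\vee\mathsf{Contraquorum} f'$; (2) consequently, if $\mathsf{Quorum}(f\vee f')$ is valid then $\mathsf{Contraquorum} f\vee\mathsf{Contraquorum} f'$ is valid.
   Context: Truth values: $\mathbf 3=\{\mathbf f,\mathbf b,\mathbf t\}$ totally ordered by $\mathbf f<\mathbf b<\mathbf t$; $\wedge,\vee$ are min and max, $\bigwedge,\bigvee$ are infimum and supremum; $(f\vee f')(p)=f(p)\vee f'(p)$. A truth value is valid iff it lies in $\{\mathbf t,\mathbf b\}$. A semitopology $(\mathcal P,\mathcal O)$ is a set $\mathcal P$ with a family $\mathcal O$ of subsets containing $\mathcal P$ and closed under arbitrary (including empty) unions; $\mathcal O^{\neq\emptyset}$ is the set of nonempty members. It is 3-twined if any three members of $\mathcal O^{\neq\emptyset}$ have nonempty intersection. For $f:\mathcal P\to\mathbf 3$: $\mathsf{Quorum} f=\bigvee_{O\in\mathcal O^{\neq\emptyset}}\bigwedge_{p\in O}f(p)$ and $\mathsf{Contraquorum} f=\bigwedge_{O\in\mathcal O^{\neq\emptyset}}\bigvee_{p\in O}f(p)$. -}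

module Defs where

open import Level using (Level; _⊔_) renaming (suc to lsuc; zero to lzero)
open import Data.Unit using (⊤)
open import Data.Product using (Σ; _×_; ∃; _,_)
open import Relation.Binary.PropositionalEquality using (_≡_)

data 𝟛 : Set where
  𝕗 𝕓 𝕥 : 𝟛

data _≤₃_ : 𝟛 → 𝟛 → Set where
  f≤ : ∀ {x} → 𝕗 ≤₃ x
  b≤b : 𝕓 ≤₃ 𝕓
  b≤t : 𝕓 ≤₃ 𝕥
  t≤t : 𝕥 ≤₃ 𝕥

_∨₃_ : 𝟛 → 𝟛 → 𝟛
𝕗 ∨₃ y = y
𝕓 ∨₃ 𝕗 = 𝕓
𝕓 ∨₃ 𝕓 = 𝕓
𝕓 ∨₃ 𝕥 = 𝕥
𝕥 ∨₃ y = 𝕥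

_∧₃_ : 𝟛 → 𝟛 → 𝟛
𝕗 ∧₃ y = 𝕗
𝕓 ∧₃ 𝕗 = 𝕗
𝕓 ∧₃ 𝕓 = 𝕓
𝕓 ∧₃ 𝕥 = 𝕓
𝕥 ∧₃ y = y

Valid : 𝟛 → Set
Valid x = 𝕓 ≤₃ x

_∨ᶠ_ : {P : Set} → (P → 𝟛) → (P → 𝟛) → P → 𝟛
(f ∨ᶠ g) p = f p ∨₃ g p

IsInf : {ℓ : Level} → (𝟛 → Set ℓ) → 𝟛 → Set ℓ
IsInf S x = (∀ y → S y → x ≤₃ y) × (∀ z → (∀ y → S y → z ≤₃ y) → z ≤₃ x)

IsSup : {ℓ : Level} → (𝟛 → Set ℓ) → 𝟛 → Set ℓ
IsSup S x = (∀ y → S y → y ≤₃ x) × (∀ z → (∀ y → S y → y ≤₃ z) → x ≤₃ z)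

Subset : Set → Set₁
Subset P = P → Set

⋃ : {P I : Set} → (I → Subset P) → Subset P
⋃ {I = I} U p = Σ I (λ i → U i p)

record IsSemitopology (P : Set) (O : Subset P → Set) : Set₁ where
  field
    full-open : O (λ _ → ⊤)
    union-open : (I : Set) (U : I → Subset P) → (∀ i → O (U i)) → O (⋃ U)

NonEmpty : {P : Set} → Subset P → Set
NonEmpty {P} A = Σ P A

ThreeTwined : (P : Set) → (Subset P → Set) → Set₁
ThreeTwined P O = ∀ (A B C : Subset P) → O A → NonEmpty A → O B → NonEmpty B
  → O C → NonEmpty C → Σ P (λ p → A p × B p × C p)

Image : {P : Set} → (P → 𝟛) → Subset P → 𝟛 → Set
Image {P} f A y = Σ P (λ p → A p × f p ≡ y)

IsQuorum : (P : Set) → (Subset P → Set) → (P → 𝟛) → 𝟛 → Set₁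
IsQuorum P O f q =
  IsSup (λ y → Σ (Subset P) (λ A → O A × NonEmpty A × IsInf (Image f A) y)) q

IsContraquorum : (P : Set) → (Subset P → Set) → (P → 𝟛) → 𝟛 → Set₁
IsContraquorum P O f c =
  IsInf (λ y → Σ (Subset P) (λ A → O A × NonEmpty A × IsSup (Image f A) y)) c

-- Given nonempty opens A, B, B′, 3-twinedness yields a point p common to all three, so
-- ⋀_A (f ∨ f′) ≤ f p ∨ f′ p ≤ ⋁_B f ∨ ⋁_B′ f′. Because 𝟛 is a chain, ∨ distributes over
-- arbitrary infima, so taking the infimum over B and B′ and then the supremum over A gives (1);
-- (2) follows since validity is upward closed.
module Submission where

open import Defs
open import Data.Empty using (⊥-elim)
open import Data.Product using (_×_; _,_)
open import Data.Sum using (_⊎_; inj₁; inj₂)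
open import Relation.Nullary using (Dec; yes; no)
open import Relation.Binary.PropositionalEquality using (refl)

_≤₃?_ : ∀ x y → Dec (x ≤₃ y)
𝕗 ≤₃? _ = yes f≤
𝕓 ≤₃? 𝕗 = no λ ()
𝕓 ≤₃? 𝕓 = yes b≤b
𝕓 ≤₃? 𝕥 = yes b≤t
𝕥 ≤₃? 𝕗 = no λ ()
𝕥 ≤₃? 𝕓 = no λ ()
𝕥 ≤₃? 𝕥 = yes t≤t

≤₃-trans : ∀ {x y z} → x ≤₃ y → y ≤₃ z → x ≤₃ z
≤₃-trans f≤ _ = f≤
≤₃-trans b≤b y≤z = y≤z
≤₃-trans b≤t t≤t = b≤t
≤₃-trans t≤t t≤t = t≤t

x≤y⇒x≤y∨₃z : ∀ {x y} z → x ≤₃ y → x ≤₃ (y ∨₃ z)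
x≤y⇒x≤y∨₃z _ f≤ = f≤
x≤y⇒x≤y∨₃z 𝕗 b≤b = b≤b
x≤y⇒x≤y∨₃z 𝕓 b≤b = b≤b
x≤y⇒x≤y∨₃z 𝕥 b≤b = b≤t
x≤y⇒x≤y∨₃z _ b≤t = b≤t
x≤y⇒x≤y∨₃z _ t≤t = t≤t

x≤y⇒x≤z∨₃y : ∀ {x y} z → x ≤₃ y → x ≤₃ (z ∨₃ y)
x≤y⇒x≤z∨₃y _ f≤ = f≤
x≤y⇒x≤z∨₃y 𝕗 x≤y = x≤y
x≤y⇒x≤z∨₃y 𝕓 b≤b = b≤b
x≤y⇒x≤z∨₃y 𝕓 b≤t = b≤t
x≤y⇒x≤z∨₃y 𝕓 t≤t = t≤t
x≤y⇒x≤z∨₃y 𝕥 b≤b = b≤t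
x≤y⇒x≤z∨₃y 𝕥 b≤t = b≤t
x≤y⇒x≤z∨₃y 𝕥 t≤t = t≤t

∨₃-lub : ∀ {x y z} → x ≤₃ z → y ≤₃ z → (x ∨₃ y) ≤₃ z
∨₃-lub {𝕗} _ y≤z = y≤z
∨₃-lub {𝕓} {𝕗} x≤z _ = x≤z
∨₃-lub {𝕓} {𝕓} x≤z _ = x≤z
∨₃-lub {𝕓} {𝕥} _ y≤z = y≤z
∨₃-lub {𝕥} x≤z _ = x≤z

∨₃-mono-≤₃ : ∀ {x y u v} → x ≤₃ y → u ≤₃ v → (x ∨₃ u) ≤₃ (y ∨₃ v)
∨₃-mono-≤₃ {y = y} {v = v} x≤y u≤v = ∨₃-lub (x≤y⇒x≤y∨₃z v x≤y) (x≤y⇒x≤z∨₃y y u≤v)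

x≤y∨₃z⇒x≤y⊎x≤z : ∀ {x} y z → x ≤₃ (y ∨₃ z) → x ≤₃ y ⊎ x ≤₃ z
x≤y∨₃z⇒x≤y⊎x≤z 𝕗 _ x≤z = inj₂ x≤z
x≤y∨₃z⇒x≤y⊎x≤z 𝕓 𝕗 x≤y = inj₁ x≤y
x≤y∨₃z⇒x≤y⊎x≤z 𝕓 𝕓 x≤y = inj₁ x≤y
x≤y∨₃z⇒x≤y⊎x≤z 𝕓 𝕥 x≤z = inj₂ x≤z
x≤y∨₃z⇒x≤y⊎x≤z 𝕥 _ x≤y = inj₁ x≤y

≤-∨₃-of-infima : ∀ {ℓ} {S S′ : 𝟛 → Set ℓ} {c c′ v : 𝟛} → IsInf S c → IsInf S′ c′
  → (∀ {s s′} → S s → S′ s′ → v ≤₃ (s ∨₃ s′)) → v ≤₃ (c ∨₃ c′)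
≤-∨₃-of-infima {S = S} {S′} {c} {c′} {v} (_ , c-greatest) (_ , c′-greatest) v≤s∨s′
  with v ≤₃? c
... | yes v≤c = x≤y⇒x≤y∨₃z c′ v≤c
... | no v≰c = x≤y⇒x≤z∨₃y c (c′-greatest v v≤S′)
  where
  v≤S′ : ∀ s′ → S′ s′ → v ≤₃ s′
  v≤S′ s′ s′∈S′ with v ≤₃? s′
  ... | yes v≤s′ = v≤s′
  ... | no v≰s′ = ⊥-elim (v≰c (c-greatest v v≤S))
    where
    v≤S : ∀ s → S s → v ≤₃ s
    v≤S s s∈S with x≤y∨₃z⇒x≤y⊎x≤z s s′ (v≤s∨s′ s∈S s′∈S′)
    ... | inj₁ v≤s = v≤s
    ... | inj₂ v≤s′ = ⊥-elim (v≰s′ v≤s′)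

threeTwined-inf≤sup∨₃sup : ∀ {P O} → ThreeTwined P O → (f f′ : P → 𝟛)
  → ∀ {A B B′ y s s′} → O A → NonEmpty A → O B → NonEmpty B → O B′ → NonEmpty B′
  → IsInf (Image (f ∨ᶠ f′) A) y → IsSup (Image f B) s → IsSup (Image f′ B′) s′
  → y ≤₃ (s ∨₃ s′)
threeTwined-inf≤sup∨₃sup twined f f′ {A} {B} {B′} oA neA oB neB oB′ neB′
  (y-lower , _) (s-upper , _) (s′-upper , _)
  with twined A B B′ oA neA oB neB oB′ neB′
... | p , p∈A , p∈B , p∈B′ =
  ≤₃-trans (y-lower _ (p , p∈A , refl))
           (∨₃-mono-≤₃ (s-upper _ (p , p∈B , refl)) (s′-upper _ (p , p∈B′ , refl)))

corollary2p15 : (P : Set) (O : Subset P → Set) → IsSemitopology P O → ThreeTwined P O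
    → (f f' : P → 𝟛) (q c c' : 𝟛)
    → IsQuorum P O (f ∨ᶠ f') q → IsContraquorum P O f c → IsContraquorum P O f' c'
    → (q ≤₃ (c ∨₃ c')) × (Valid q → Valid (c ∨₃ c'))
corollary2p15 P O _ twined f f' q c c' (_ , q-least) c-inf c'-inf =
  q≤c∨c' , λ valid-q → ≤₃-trans valid-q q≤c∨c'
  where
  q≤c∨c' : q ≤₃ (c ∨₃ c')
  q≤c∨c' = q-least (c ∨₃ c') λ y (A , oA , neA , y-inf) →
    ≤-∨₃-of-infima c-inf c'-inf λ (B , oB , neB , s-sup) (B′ , oB′ , neB′ , s′-sup) →
      threeTwined-inf≤sup∨₃sup twined f f' oA neA oB neB oB′ neB′ y-inf s-sup s′-sup
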